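{- Let $G=(V,E)$ be a finite simple undirected graph with $m=|E|\ge1$, let $V_1,\dots,V_k$ be a partition of $V$ into nonempty sets, let $\psi\in\{\alpha,\phi\}$ be one of the two local triadic coefficients, and let $q\in[0,\tfrac12]$. Let $e$ be an edge sampled uniformly at random from $E$, $p=1/m$, and $X_{e'}$ the $0$--$1$ indicator that $e'\in E$ is the sampled edge. For $j\in[k]$ define $$f_j(e)=\sum_{e'\in E}\frac{X_{e'}}{p}\,\frac{1}{|V_j|}\sum_{v\in V_j}\frac{a_q(v,e')}{|W^{*}_v|},\qquad a_q(v,e')=q\,|\Delta_{e'}|\,\mathbf{1}[v\in e']+(1-2q)\,\mathbf{1}[v\in\mathcal{N}_{e'}].$$ Then for every $j\in[k]$, $\mathbb{E}[f_j(e)]=\Psi_j:=\frac{1}{|V_j|}\sum_{v\in V_j}\psi_v$.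
   Context: $\mathcal{N}_v$ is the neighborhood of $v$, $d_v=|\mathcal{N}_v|$ its degree. For an edge $e=\{u,v\}$, $\mathcal{N}_e=\mathcal{N}_u\cap\mathcal{N}_v$. A triangle is a set of three edges pairwise sharing a node, on three distinct nodes; $\Delta_v$ (resp. $\Delta_e$) is the set of triangles containing node $v$ (resp. edge $e$). The number of wedges centered at $v$ is $|W^c_v|=\binom{d_v}{2}$, and the number of wedges headed at $v$ is $|W^h_v|=\sum_{u\in\mathcal{N}_v}(d_u-1)$. The local clustering coefficient is $\alpha_v=|\Delta_v|/|W^c_v|$ and the local closure coefficient is $\phi_v=2|\Delta_v|/|W^h_v|$. Set $|W^*_v|=|W^c_v|$ if $\psi=\alpha$ and $|W^*_v|=|W^h_v|/2$ if $\psi=\phi$, so that $\psi_v=|\Delta_v|/|W^*_v|$. Convention: when $|W^*_v|=0$ (in which case $v$ lies in no triangle), all quotients with denominator $|W^*_v|$ are taken to be $0$. -}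

module Defs where

open import Data.Nat as ℕ using (ℕ; zero; suc; _∸_)
open import Data.Nat.Combinatorics using (_C_)
open import Data.Fin using (Fin; toℕ)
open import Data.Bool using (Bool; true; false; _∧_; _∨_; if_then_else_)
open import Data.List using (List; []; _∷_; [_]; length; allFin; filterᵇ; concatMap; foldr; map)
open import Data.Integer using (+_)
open import Data.Rational using (ℚ; 0ℚ; 1ℚ; ½; _+_; _*_; _-_; _÷_; _/_; ≢-nonZero)
import Data.Rational.Properties as ℚP
open import Data.Product using (_×_; _,_; proj₁; proj₂)
open import Relation.Binary.PropositionalEquality using (_≡_)
open import Relation.Nullary using (yes; no)

record Graph : Set where
  field
    n          : ℕ
    adj        : Fin n → Fin n → Bool
    adj-sym    : ∀ u v → adj u v ≡ adj v u
    adj-irrefl : ∀ v → adj v v ≡ false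
open Graph public

_=ᵛ_ : ∀ {n} → Fin n → Fin n → Bool
a =ᵛ b = toℕ a ℕ.≡ᵇ toℕ b

ℕ→ℚ : ℕ → ℚ
ℕ→ℚ k = + k / 1

sumℚ : ∀ {A : Set} → List A → (A → ℚ) → ℚ
sumℚ xs f = foldr (λ x acc → f x + acc) 0ℚ xs

-- Division with the convention x / 0 = 0
_÷₀_ : ℚ → ℚ → ℚ
x ÷₀ y with y Data.Rational.≟ 0ℚ
... | yes _ = 0ℚ
... | no y≢0 = _÷_ x y {{≢-nonZero y≢0}}

module _ (G : Graph) where
  V : List (Fin (n G))
  V = allFin (n G)

  -- Edge set: each edge {u,v} listed once as (u , v) with u < v.
  Edge : Set
  Edge = Fin (n G) × Fin (n G)

  edges : List Edge
  edges = concatMap (λ u → concatMap (λ v →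
            if (toℕ u ℕ.<ᵇ toℕ v) ∧ adj G u v then [ (u , v) ] else []) V) V

  _=ᵉ_ : Edge → Edge → Bool
  (a , b) =ᵉ (c , d) = (a =ᵛ c) ∧ (b =ᵛ d)

  N : Fin (n G) → List (Fin (n G))
  N v = filterᵇ (adj G v) V

  deg : Fin (n G) → ℕ
  deg v = length (N v)

  -- Triangles, represented by their node sets {a,b,c} with a < b < c
  -- pairwise adjacent (equivalently: the three edges ab, bc, ac).
  Triangle : Set
  Triangle = Fin (n G) × Fin (n G) × Fin (n G)

  triangles : List Triangle
  triangles = concatMap (λ a → concatMap (λ b → concatMap (λ c →
      if (toℕ a ℕ.<ᵇ toℕ b) ∧ (toℕ b ℕ.<ᵇ toℕ c)
         ∧ adj G a b ∧ adj G b c ∧ adj G a c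
      then [ (a , b , c) ] else []) V) V) V

  onTri : Fin (n G) → Triangle → Bool
  onTri v (a , b , c) = (v =ᵛ a) ∨ (v =ᵛ b) ∨ (v =ᵛ c)

  Δv : Fin (n G) → ℕ
  Δv v = length (filterᵇ (onTri v) triangles)

  Δe : Edge → ℕ
  Δe (u , w) = length (filterᵇ (λ t → onTri u t ∧ onTri w t) triangles)

  Wc : Fin (n G) → ℕ
  Wc v = deg v C 2

  Wh : Fin (n G) → ℕ
  Wh v = foldr (λ u acc → (deg u ∸ 1) ℕ.+ acc) 0 (N v)

data Coef : Set where
  α φ : Coef

module _ (G : Graph) where
  Wstar : Coef → Fin (n G) → ℚ
  Wstar α v = ℕ→ℚ (Wc G v)
  Wstar φ v = ℕ→ℚ (Wh G v) * ½

  -- ψ_v = |Δ_v| / |W*_v| (0 if |W*_v| = 0)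
  coef : Coef → Fin (n G) → ℚ
  coef ψ v = ℕ→ℚ (Δv G v) ÷₀ Wstar ψ v

  indℚ : Bool → ℚ
  indℚ b = if b then 1ℚ else 0ℚ

  inEdge : Fin (n G) → Edge G → Bool
  inEdge v (a , b) = (v =ᵛ a) ∨ (v =ᵛ b)

  inNe : Fin (n G) → Edge G → Bool
  inNe v (a , b) = adj G a v ∧ adj G b v

  aq : ℚ → Fin (n G) → Edge G → ℚ
  aq q v e' = q * ℕ→ℚ (Δe G e') * indℚ (inEdge v e')
              + (1ℚ - ℕ→ℚ 2 * q) * indℚ (inNe v e')

  module _ {k : ℕ} (part : Fin (n G) → Fin k) where
    block : Fin k → List (Fin (n G))
    block j = filterᵇ (λ v → part v =ᵛ j) (V G)

    m : ℕ
    m = length (edges G)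

    p : ℚ
    p = 1ℚ ÷₀ ℕ→ℚ m

    X : Edge G → Edge G → ℚ
    X e e' = indℚ (_=ᵉ_ G e' e)

    f : Coef → ℚ → Fin k → Edge G → ℚ
    f ψ q j e = sumℚ (edges G) (λ e' →
        (X e e' ÷₀ p) * ((1ℚ ÷₀ ℕ→ℚ (length (block j)))
           * sumℚ (block j) (λ v → aq q v e' ÷₀ Wstar ψ v)))

    expect : (Edge G → ℚ) → ℚ
    expect g = sumℚ (edges G) (λ e → (1ℚ ÷₀ ℕ→ℚ m) * g e)

    Ψ : Coef → Fin k → ℚ
    Ψ ψ j = (1ℚ ÷₀ ℕ→ℚ (length (block j))) * sumℚ (block j) (coef ψ)

{-# OPTIONS --safe #-}

-- Averaging over the uniformly sampled edge e cancels the weight X_{e'}/p, so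
-- E[f_j(e)] = (1/|V_j|) Σ_{v ∈ V_j} (Σ_{e'} a_q(v,e')) / |W*_v|, and it suffices that
-- Σ_{e'} a_q(v,e') = |Δ_v| for every v.  A triangle through v has two edges at v and one
-- edge opposite v; hence Σ_{e' ∋ v} |Δ_{e'}| = 2|Δ_v| and #{e' : v ∈ N_{e'}} = |Δ_v|,
-- and q·2|Δ_v| + (1 - 2q)|Δ_v| = |Δ_v|.  Sums over the edge and triangle lists are
-- computed as sums over all ordered vertex pairs and triples weighted by 0/1 indicators.

module Submission where

open import Defs
open import Data.Nat using (ℕ; _≤_)
open import Data.Fin using (Fin)
open import Data.List using (length)
open import Data.Rational using (ℚ; 0ℚ; ½)
open import Data.Product using (∃)
open import Relation.Binary.PropositionalEquality using (_≡_)

open import Data.Bool using (Bool; true; false; T; _∧_; _∨_; if_then_else_)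
open import Data.Bool.Properties using (∧-zeroʳ; T-≡; T-∧; T-∨)
open import Data.Empty using (⊥; ⊥-elim)
open import Data.Fin using (zero; suc; toℕ)
open import Data.Fin.Properties using (toℕ-injective)
open import Data.Integer as ℤ using ()
open import Data.Integer.Properties as ℤ using ()
open import Data.List using (List; []; _∷_; [_]; _++_; map; concatMap; filterᵇ; allFin)
open import Data.List.Properties using (map-tabulate)
open import Data.Nat using (zero; suc; _<_; _<ᵇ_; _≡ᵇ_; z≤n; s≤s)
open import Data.Nat.Coprimality using (1-coprimeTo) renaming (sym to coprime-sym)
open import Data.Nat.Properties using (<⇒<ᵇ; <ᵇ⇒<; <⇒≢; <⇒≯; <-trans; <-cmp; ≡ᵇ⇒≡; ≮⇒≥)
open import Data.Product using (_,_; proj₂)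
open import Data.Sum using (inj₁; inj₂)
open import Data.Rational using (1ℚ; _+_; _*_; _-_; mkℚ; 1/_; ≢-nonZero; _≟_)
open import Data.Rational.Properties
  using (+-identityˡ; +-identityʳ; +-assoc; *-identityˡ; *-zeroˡ; *-zeroʳ; *-assoc;
         *-distribˡ-+; *-distribʳ-+; *-inverseˡ; 1≢0; 1/-involutive; normalize-coprime; /-cong;
         +-0-commutativeMonoid)
open import Data.Rational.Solver using (module +-*-Solver)
open import Algebra.Bundles using (CommutativeMonoid)
open import Algebra.Properties.CommutativeSemigroup
  (CommutativeMonoid.commutativeSemigroup +-0-commutativeMonoid) using (interchange)
open import Function using (_∘_; Equivalence)
open import Relation.Binary.PropositionalEquality using (_≢_; refl; sym; trans; cong; cong₂; subst; module ≡-Reasoning)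
open import Relation.Binary.Definitions using (tri<; tri≈; tri>)
open import Relation.Nullary using (¬_; yes; no)

open +-*-Solver using (solve; _:+_; _:*_; _:-_; _:=_; con)
open ≡-Reasoning

ℕ→ℚ≡mkℚ : ∀ k → ℕ→ℚ k ≡ mkℚ (ℤ.+ k) 0 (coprime-sym (1-coprimeTo k))
ℕ→ℚ≡mkℚ k = normalize-coprime (coprime-sym (1-coprimeTo k))

ℕ→ℚ-suc : ∀ k → ℕ→ℚ (suc k) ≡ 1ℚ + ℕ→ℚ k
-- 1ℚ + mkℚ (+ k) 0 _ computes to (+ 1 + + k * + 1) / 1.
ℕ→ℚ-suc k = begin
  ℕ→ℚ (suc k)
    ≡⟨ /-cong (cong (ℤ._+_ (ℤ.+ 1)) (sym (ℤ.*-identityʳ (ℤ.+ k)))) refl ⟩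
  1ℚ + mkℚ (ℤ.+ k) 0 (coprime-sym (1-coprimeTo k))
    ≡⟨ cong (1ℚ +_) (ℕ→ℚ≡mkℚ k) ⟨
  1ℚ + ℕ→ℚ k
    ∎

ℕ→ℚ-≢0 : ∀ {k} → 1 ≤ k → ℕ→ℚ k ≢ 0ℚ
ℕ→ℚ-≢0 {suc k} _ eq with trans (sym (ℕ→ℚ≡mkℚ (suc k))) eq
... | ()

x÷₀y≡x*[1÷₀y] : ∀ x y → x ÷₀ y ≡ x * (1ℚ ÷₀ y)
x÷₀y≡x*[1÷₀y] x y with y ≟ 0ℚ
... | yes _ = sym (*-zeroʳ x)
... | no _  = cong (x *_) (sym (*-identityˡ _))

1÷₀-inverseˡ : ∀ y → y ≢ 0ℚ → (1ℚ ÷₀ y) * y ≡ 1ℚ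
1÷₀-inverseˡ y y≢0 with y ≟ 0ℚ
... | yes y≡0 = ⊥-elim (y≢0 y≡0)
... | no y≢0′ = trans (cong (_* y) (*-identityˡ (1/ y))) (*-inverseˡ y)
  where instance _ = ≢-nonZero y≢0′

1÷₀-involutive : ∀ y → 1ℚ ÷₀ (1ℚ ÷₀ y) ≡ y
1÷₀-involutive y with y ≟ 0ℚ
... | yes refl = refl
... | no y≢0 = begin
  1ℚ ÷₀ (1ℚ * 1/ y)  ≡⟨ cong (1ℚ ÷₀_) (*-identityˡ (1/ y)) ⟩
  1ℚ ÷₀ (1/ y)       ≡⟨ recip-of-recip ⟩
  y                  ∎
  where
  instance _ = ≢-nonZero y≢0
  recip-of-recip : 1ℚ ÷₀ (1/ y) ≡ y
  recip-of-recip with (1/ y) ≟ 0ℚ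
  ... | yes 1/y≡0 = ⊥-elim (1≢0 (begin
          1ℚ          ≡⟨ sym (*-inverseˡ y) ⟩
          1/ y * y    ≡⟨ cong (_* y) 1/y≡0 ⟩
          0ℚ * y      ≡⟨ *-zeroˡ y ⟩
          0ℚ          ∎))
  ... | no y⁻¹≢0 = trans (*-identityˡ ((1/ (1/ y)) {{≢-nonZero y⁻¹≢0}})) (1/-involutive y)

-- Definitionally equal to indℚ G.
𝟙 : Bool → ℚ
𝟙 b = if b then 1ℚ else 0ℚ

𝟙-∧ : ∀ x y → 𝟙 (x ∧ y) ≡ 𝟙 x * 𝟙 y
𝟙-∧ true  y = sym (*-identityˡ (𝟙 y))
𝟙-∧ false y = sym (*-zeroˡ (𝟙 y))

𝟙-∧₅ : ∀ p q r s t → 𝟙 (p ∧ q ∧ r ∧ s ∧ t) ≡ 𝟙 p * (𝟙 q * (𝟙 r * (𝟙 s * 𝟙 t)))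
𝟙-∧₅ p q r s t =
  trans (𝟙-∧ p _) (cong (𝟙 p *_) (trans (𝟙-∧ q _) (cong (𝟙 q *_) (trans (𝟙-∧ r _) (cong (𝟙 r *_) (𝟙-∧ s t))))))

𝟙-∧-hoist : ∀ x y z r → 𝟙 x * (𝟙 (y ∧ z) * r) ≡ 𝟙 y * (𝟙 z * (𝟙 x * r))
𝟙-∧-hoist x y z r = trans (cong (λ s → 𝟙 x * (s * r)) (𝟙-∧ y z))
  (solve 4 (λ X Y Z R → X :* ((Y :* Z) :* R) := Y :* (Z :* (X :* R))) refl (𝟙 x) (𝟙 y) (𝟙 z) r)

𝟙-∨ : ∀ x y → (T x → T y → ⊥) → 𝟙 (x ∨ y) ≡ 𝟙 x + 𝟙 y
𝟙-∨ true  true  excl = ⊥-elim (excl _ _)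
𝟙-∨ true  false excl = refl
𝟙-∨ false y     excl = sym (+-identityˡ (𝟙 y))

𝟙-true-* : ∀ {x} p → x ≡ true → 𝟙 x * p ≡ p
𝟙-true-* p refl = *-identityˡ p

𝟙-false-* : ∀ {x} p → x ≡ false → 𝟙 x * p ≡ 0ℚ
𝟙-false-* p refl = *-zeroˡ p

𝟙-guard : ∀ x {p q} → (T x → p ≡ q) → 𝟙 x * p ≡ 𝟙 x * q
𝟙-guard true  p≡q = cong (1ℚ *_) (p≡q _)
𝟙-guard false {p} {q} _ = trans (*-zeroˡ p) (sym (*-zeroˡ q))

module _ {A : Set} where

  sum-cong : ∀ (xs : List A) {f g : A → ℚ} → (∀ x → f x ≡ g x) → sumℚ xs f ≡ sumℚ xs g
  sum-cong []       f≗g = refl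
  sum-cong (x ∷ xs) f≗g = cong₂ _+_ (f≗g x) (sum-cong xs f≗g)

  sum-zero : ∀ (xs : List A) → sumℚ xs (λ _ → 0ℚ) ≡ 0ℚ
  sum-zero []       = refl
  sum-zero (x ∷ xs) = trans (+-identityˡ _) (sum-zero xs)

  sum-+ : ∀ (xs : List A) (f g : A → ℚ) → sumℚ xs (λ x → f x + g x) ≡ sumℚ xs f + sumℚ xs g
  sum-+ []       f g = refl
  sum-+ (x ∷ xs) f g = trans (cong (f x + g x +_) (sum-+ xs f g)) (interchange (f x) (g x) _ _)

  sum-+₃ : ∀ (xs : List A) (f g h : A → ℚ) →
           sumℚ xs (λ x → f x + (g x + h x)) ≡ sumℚ xs f + (sumℚ xs g + sumℚ xs h)
  sum-+₃ xs f g h = trans (sum-+ xs f _) (cong (sumℚ xs f +_) (sum-+ xs g h))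

  sum-*ˡ : ∀ (xs : List A) c (f : A → ℚ) → sumℚ xs (λ x → c * f x) ≡ c * sumℚ xs f
  sum-*ˡ []       c f = sym (*-zeroʳ c)
  sum-*ˡ (x ∷ xs) c f = trans (cong (c * f x +_) (sum-*ˡ xs c f)) (sym (*-distribˡ-+ c (f x) _))

  sum-*ʳ : ∀ (xs : List A) c (f : A → ℚ) → sumℚ xs (λ x → f x * c) ≡ sumℚ xs f * c
  sum-*ʳ []       c f = sym (*-zeroˡ c)
  sum-*ʳ (x ∷ xs) c f = trans (cong (f x * c +_) (sum-*ʳ xs c f)) (sym (*-distribʳ-+ c (f x) _))

  sum-÷₀ : ∀ (xs : List A) (f : A → ℚ) y → sumℚ xs (λ x → f x ÷₀ y) ≡ sumℚ xs f ÷₀ y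
  sum-÷₀ xs f y = begin
    sumℚ xs (λ x → f x ÷₀ y)             ≡⟨ sum-cong xs (λ x → x÷₀y≡x*[1÷₀y] (f x) y) ⟩
    sumℚ xs (λ x → f x * (1ℚ ÷₀ y))      ≡⟨ sum-*ʳ xs _ f ⟩
    sumℚ xs f * (1ℚ ÷₀ y)                ≡⟨ sym (x÷₀y≡x*[1÷₀y] _ y) ⟩
    sumℚ xs f ÷₀ y                       ∎

  sum-++ : ∀ (xs ys : List A) (f : A → ℚ) → sumℚ (xs ++ ys) f ≡ sumℚ xs f + sumℚ ys f
  sum-++ []       ys f = sym (+-identityˡ _)
  sum-++ (x ∷ xs) ys f = trans (cong (f x +_) (sum-++ xs ys f)) (sym (+-assoc (f x) _ _))

  sum-if-singleton : ∀ b (x : A) f → sumℚ (if b then [ x ] else []) f ≡ 𝟙 b * f x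
  sum-if-singleton true  x f = trans (+-identityʳ (f x)) (sym (*-identityˡ (f x)))
  sum-if-singleton false x f = sym (*-zeroˡ (f x))

  length-filterᵇ : ∀ (P : A → Bool) xs → ℕ→ℚ (length (filterᵇ P xs)) ≡ sumℚ xs (𝟙 ∘ P)
  length-filterᵇ P []       = refl
  length-filterᵇ P (x ∷ xs) with P x
  ... | true  = trans (ℕ→ℚ-suc (length (filterᵇ P xs))) (cong (1ℚ +_) (length-filterᵇ P xs))
  ... | false = trans (length-filterᵇ P xs) (sym (+-identityˡ (sumℚ xs (𝟙 ∘ P))))

module _ {A B : Set} where

  sum-map : ∀ (g : B → A) xs (f : A → ℚ) → sumℚ (map g xs) f ≡ sumℚ xs (f ∘ g)
  sum-map g []       f = refl
  sum-map g (x ∷ xs) f = cong (f (g x) +_) (sum-map g xs f)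

  sum-concatMap : ∀ (g : A → List B) xs (f : B → ℚ) →
                  sumℚ (concatMap g xs) f ≡ sumℚ xs (λ x → sumℚ (g x) f)
  sum-concatMap g []       f = refl
  sum-concatMap g (x ∷ xs) f = trans (sum-++ (g x) _ f) (cong (sumℚ (g x) f +_) (sum-concatMap g xs f))

  sum-comm : ∀ xs ys (f : A → B → ℚ) →
             sumℚ xs (λ x → sumℚ ys (f x)) ≡ sumℚ ys (λ y → sumℚ xs (λ x → f x y))
  sum-comm []       ys f = sym (sum-zero ys)
  sum-comm (x ∷ xs) ys f = trans (cong (sumℚ ys (f x) +_) (sum-comm xs ys f)) (sym (sum-+ ys (f x) _))

≡ᵇ-sym : ∀ m n → (m ≡ᵇ n) ≡ (n ≡ᵇ m)
≡ᵇ-sym zero    zero    = refl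
≡ᵇ-sym zero    (suc n) = refl
≡ᵇ-sym (suc m) zero    = refl
≡ᵇ-sym (suc m) (suc n) = ≡ᵇ-sym m n

=ᵛ⇒≡ : ∀ {k} {a b : Fin k} → T (a =ᵛ b) → a ≡ b
=ᵛ⇒≡ {a = a} {b} a=b = toℕ-injective (≡ᵇ⇒≡ (toℕ a) (toℕ b) a=b)

=ᵛ-exclusive : ∀ {k} {v a b : Fin k} → toℕ a < toℕ b → T (v =ᵛ a) → T (v =ᵛ b) → ⊥
=ᵛ-exclusive {v = v} a<b v=a v=b = <⇒≢ a<b (cong toℕ (trans (sym (=ᵛ⇒≡ {a = v} v=a)) (=ᵛ⇒≡ {a = v} v=b)))

=ᵛ-∨-split : ∀ {k} {a b : Fin k} → toℕ a < toℕ b → ∀ v → 𝟙 ((v =ᵛ a) ∨ (v =ᵛ b)) ≡ 𝟙 (v =ᵛ a) + 𝟙 (v =ᵛ b)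
=ᵛ-∨-split a<b v = 𝟙-∨ _ _ (=ᵛ-exclusive {v = v} a<b)

sum-allFin-suc : ∀ k (f : Fin (suc k) → ℚ) → sumℚ (allFin (suc k)) f ≡ f zero + sumℚ (allFin k) (f ∘ suc)
sum-allFin-suc k f =
  cong (f zero +_) (trans (cong (λ xs → sumℚ xs f) (sym (map-tabulate (λ x → x) suc))) (sum-map suc (allFin k) f))

sum-δ : ∀ {k} (v : Fin k) (f : Fin k → ℚ) → sumℚ (allFin k) (λ x → 𝟙 (x =ᵛ v) * f x) ≡ f v
sum-δ {suc k} zero f = begin
  sumℚ (allFin (suc k)) (λ x → 𝟙 (x =ᵛ zero) * f x)  ≡⟨ sum-allFin-suc k (λ x → 𝟙 (x =ᵛ zero) * f x) ⟩
  1ℚ * f zero + sumℚ (allFin k) (λ x → 0ℚ * f (suc x)) ≡⟨ cong₂ _+_ (*-identityˡ (f zero)) sum-0* ⟩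
  f zero + 0ℚ                                        ≡⟨ +-identityʳ (f zero) ⟩
  f zero                                             ∎
  where
  sum-0* : sumℚ (allFin k) (λ x → 0ℚ * f (suc x)) ≡ 0ℚ
  sum-0* = trans (sum-cong (allFin k) (λ x → *-zeroˡ (f (suc x)))) (sum-zero (allFin k))
sum-δ {suc k} (suc v) f = begin
  sumℚ (allFin (suc k)) (λ x → 𝟙 (x =ᵛ suc v) * f x)
    ≡⟨ sum-allFin-suc k (λ x → 𝟙 (x =ᵛ suc v) * f x) ⟩
  0ℚ * f zero + sumℚ (allFin k) (λ x → 𝟙 (x =ᵛ v) * f (suc x))
    ≡⟨ cong₂ _+_ (*-zeroˡ (f zero)) (sum-δ v (f ∘ suc)) ⟩
  0ℚ + f (suc v)
    ≡⟨ +-identityˡ (f (suc v)) ⟩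
  f (suc v)
    ∎

sum-δ′ : ∀ {k} (v : Fin k) (f : Fin k → ℚ) → sumℚ (allFin k) (λ x → 𝟙 (v =ᵛ x) * f x) ≡ f v
sum-δ′ {k} v f = trans (sum-cong (allFin k) (λ x → cong (λ b → 𝟙 b * f x) (≡ᵇ-sym (toℕ v) (toℕ x)))) (sum-δ v f)

<ᵇ-true : ∀ {m n} → m < n → (m <ᵇ n) ≡ true
<ᵇ-true m<n = Equivalence.to T-≡ (<⇒<ᵇ m<n)

<ᵇ-false : ∀ {m n} → ¬ m < n → (m <ᵇ n) ≡ false
<ᵇ-false m≮n = ≤⇒≮ᵇ (≮⇒≥ m≮n)
  where
  ≤⇒≮ᵇ : ∀ {m n} → n ≤ m → (m <ᵇ n) ≡ false
  ≤⇒≮ᵇ z≤n       = refl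
  ≤⇒≮ᵇ (s≤s n≤m) = ≤⇒≮ᵇ n≤m

𝟙<ᵇ-by-position : ∀ {x y v} → x ≢ v → y ≢ v →
  𝟙 (x <ᵇ y) ≡ 𝟙 (v <ᵇ x) * 𝟙 (x <ᵇ y) + (𝟙 (x <ᵇ v) * 𝟙 (v <ᵇ y) + 𝟙 (x <ᵇ y) * 𝟙 (y <ᵇ v))
𝟙<ᵇ-by-position {x} {y} {v} x≢v y≢v with <-cmp x v | <-cmp y v
... | tri≈ _ x≡v _ | _            = ⊥-elim (x≢v x≡v)
... | _            | tri≈ _ y≡v _ = ⊥-elim (y≢v y≡v)
... | tri< x<v _ v≮x | tri< y<v _ v≮y
  rewrite <ᵇ-true x<v | <ᵇ-false v≮x | <ᵇ-true y<v | <ᵇ-false v≮y =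
  solve 1 (λ p → p := con 0ℚ :* p :+ (con 1ℚ :* con 0ℚ :+ p :* con 1ℚ)) refl (𝟙 (x <ᵇ y))
... | tri< x<v _ v≮x | tri> y≮v _ v<y
  rewrite <ᵇ-true (<-trans x<v v<y) | <ᵇ-true x<v | <ᵇ-false v≮x | <ᵇ-true v<y | <ᵇ-false y≮v = refl
... | tri> x≮v _ v<x | tri< y<v _ v≮y
  rewrite <ᵇ-false (<⇒≯ (<-trans y<v v<x)) | <ᵇ-true v<x | <ᵇ-false x≮v | <ᵇ-false v≮y | <ᵇ-true y<v = refl
... | tri> x≮v _ v<x | tri> y≮v _ v<y
  rewrite <ᵇ-true v<x | <ᵇ-false x≮v | <ᵇ-true v<y | <ᵇ-false y≮v =
  solve 1 (λ p → p := con 1ℚ :* p :+ (con 0ℚ :* con 1ℚ :+ p :* con 0ℚ)) refl (𝟙 (x <ᵇ y))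

sum-δ₃ : ∀ {k} (a b c : Fin k) (f : Fin k → ℚ) →
         sumℚ (allFin k) (λ x → (𝟙 (x =ᵛ a) + (𝟙 (x =ᵛ b) + 𝟙 (x =ᵛ c))) * f x) ≡ f a + (f b + f c)
sum-δ₃ {k} a b c f = begin
  sumℚ (allFin k) (λ x → (𝟙 (x =ᵛ a) + (𝟙 (x =ᵛ b) + 𝟙 (x =ᵛ c))) * f x)
    ≡⟨ sum-cong (allFin k) (λ x → distrib (𝟙 (x =ᵛ a)) (𝟙 (x =ᵛ b)) (𝟙 (x =ᵛ c)) (f x)) ⟩
  sumℚ (allFin k) (λ x → 𝟙 (x =ᵛ a) * f x + (𝟙 (x =ᵛ b) * f x + 𝟙 (x =ᵛ c) * f x))
    ≡⟨ sum-+₃ (allFin k) (δ a) (δ b) (δ c) ⟩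
  sumℚ (allFin k) (δ a) + (sumℚ (allFin k) (δ b) + sumℚ (allFin k) (δ c))
    ≡⟨ cong₂ _+_ (sum-δ a f) (cong₂ _+_ (sum-δ b f) (sum-δ c f)) ⟩
  f a + (f b + f c) ∎
  where
  δ : Fin k → Fin k → ℚ
  δ y x = 𝟙 (x =ᵛ y) * f x
  distrib : ∀ p q r s → (p + (q + r)) * s ≡ p * s + (q * s + r * s)
  distrib p q r s = trans (*-distribʳ-+ s p (q + r)) (cong (p * s +_) (*-distribʳ-+ s q r))

-- Edges and triangles

module _ (G : Graph) where

  private
    Vertex = Fin (n G)

  ∑ : (Vertex → ℚ) → ℚ
  ∑ = sumℚ (V G)

  ∑² : (Vertex → Vertex → ℚ) → ℚ
  ∑² f = ∑ (λ x → ∑ (f x))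

  ∑³ : (Vertex → Vertex → Vertex → ℚ) → ℚ
  ∑³ f = ∑ (λ x → ∑² (f x))

  ∑²-cong : ∀ {f g : Vertex → Vertex → ℚ} → (∀ x y → f x y ≡ g x y) → ∑² f ≡ ∑² g
  ∑²-cong f≗g = sum-cong (V G) (λ x → sum-cong (V G) (f≗g x))

  ∑³-cong : ∀ {f g : Vertex → Vertex → Vertex → ℚ} → (∀ x y z → f x y z ≡ g x y z) → ∑³ f ≡ ∑³ g
  ∑³-cong f≗g = sum-cong (V G) (λ x → ∑²-cong (f≗g x))

  ∑²-+₃ : ∀ (f g h : Vertex → Vertex → ℚ) →
          ∑² (λ x y → f x y + (g x y + h x y)) ≡ ∑² f + (∑² g + ∑² h)
  ∑²-+₃ f g h = trans (sum-cong (V G) (λ x → sum-+₃ (V G) (f x) (g x) (h x)))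
                      (sum-+₃ (V G) (λ x → ∑ (f x)) (λ x → ∑ (g x)) (λ x → ∑ (h x)))

  ∑³-+₃ : ∀ (f g h : Vertex → Vertex → Vertex → ℚ) →
          ∑³ (λ x y z → f x y z + (g x y z + h x y z)) ≡ ∑³ f + (∑³ g + ∑³ h)
  ∑³-+₃ f g h = trans (sum-cong (V G) (λ x → ∑²-+₃ (f x) (g x) (h x)))
                      (sum-+₃ (V G) (λ x → ∑² (f x)) (λ x → ∑² (g x)) (λ x → ∑² (h x)))

  isEdge : Vertex → Vertex → Bool
  isEdge u w = (toℕ u <ᵇ toℕ w) ∧ adj G u w

  onPairs : (Edge G → ℚ) → Vertex → Vertex → ℚ
  onPairs g u w = 𝟙 (isEdge u w) * g (u , w)

  isTriangle : Vertex → Vertex → Vertex → Bool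
  isTriangle a b c = (toℕ a <ᵇ toℕ b) ∧ (toℕ b <ᵇ toℕ c) ∧ adj G a b ∧ adj G b c ∧ adj G a c

  sum-edges : ∀ (g : Edge G → ℚ) → sumℚ (edges G) g ≡ ∑² (onPairs g)
  sum-edges g =
    trans (sum-concatMap _ (V G) g) (sum-cong (V G) λ u →
    trans (sum-concatMap _ (V G) g) (sum-cong (V G) λ w →
    sum-if-singleton (isEdge u w) (u , w) g))

  sum-triangles : ∀ (g : Triangle G → ℚ) →
                  sumℚ (triangles G) g ≡ ∑³ (λ a b c → 𝟙 (isTriangle a b c) * g (a , b , c))
  sum-triangles g =
    trans (sum-concatMap _ (V G) g) (sum-cong (V G) λ a →
    trans (sum-concatMap _ (V G) g) (sum-cong (V G) λ b →
    trans (sum-concatMap _ (V G) g) (sum-cong (V G) λ c →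
    sum-if-singleton (isTriangle a b c) (a , b , c) g)))

  sum-edges-cong : ∀ {g h : Edge G → ℚ} → (∀ u w → T (isEdge u w) → g (u , w) ≡ h (u , w)) →
                   sumℚ (edges G) g ≡ sumℚ (edges G) h
  sum-edges-cong {g} {h} g≗h = begin
    sumℚ (edges G) g                                ≡⟨ sum-edges g ⟩
    ∑² (onPairs g)                                  ≡⟨ ∑²-cong (λ u w → 𝟙-guard (isEdge u w) (g≗h u w)) ⟩
    ∑² (onPairs h)                                  ≡⟨ sum-edges h ⟨
    sumℚ (edges G) h                                ∎

  sum-triangles-cong : ∀ {g h : Triangle G → ℚ} →
                       (∀ a b c → T (isTriangle a b c) → g (a , b , c) ≡ h (a , b , c)) →
                       sumℚ (triangles G) g ≡ sumℚ (triangles G) h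
  sum-triangles-cong {g} {h} g≗h = begin
    sumℚ (triangles G) g                                       ≡⟨ sum-triangles g ⟩
    ∑³ (λ a b c → 𝟙 (isTriangle a b c) * g (a , b , c))        ≡⟨ ∑³-cong (λ a b c → 𝟙-guard (isTriangle a b c) (g≗h a b c)) ⟩
    ∑³ (λ a b c → 𝟙 (isTriangle a b c) * h (a , b , c))        ≡⟨ sum-triangles h ⟨
    sumℚ (triangles G) h                                       ∎

  adj⇒≢ : ∀ {x y} → T (adj G x y) → toℕ x ≢ toℕ y
  adj⇒≢ {x} x~y x≡y with toℕ-injective x≡y
  ... | refl = subst T (adj-irrefl G x) x~y

  record TriangleFacts (a b c : Vertex) : Set where
    field
      a<b : toℕ a < toℕ b
      b<c : toℕ b < toℕ c
      a~b : T (adj G a b)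
      b~c : T (adj G b c)
      a~c : T (adj G a c)

  isTriangle⇒ : ∀ {a b c} → T (isTriangle a b c) → TriangleFacts a b c
  isTriangle⇒ {a} {b} {c} abc =
    let a<b , t₁ = Equivalence.to T-∧ abc
        b<c , t₂ = Equivalence.to T-∧ t₁
        a~b , t₃ = Equivalence.to T-∧ t₂
        b~c , a~c = Equivalence.to T-∧ t₃
    in record { a<b = <ᵇ⇒< (toℕ a) (toℕ b) a<b ; b<c = <ᵇ⇒< (toℕ b) (toℕ c) b<c
              ; a~b = a~b ; b~c = b~c ; a~c = a~c }

  isEdge-irrefl : ∀ x → isEdge x x ≡ false
  isEdge-irrefl x = trans (cong ((toℕ x <ᵇ toℕ x) ∧_) (adj-irrefl G x)) (∧-zeroʳ _)

  isEdge-reverse : ∀ {x y} → toℕ x < toℕ y → isEdge y x ≡ false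
  isEdge-reverse {x} {y} x<y = cong (_∧ adj G y x) (<ᵇ-false (<⇒≯ x<y))

  isEdge-intro : ∀ {x y} → toℕ x < toℕ y → T (adj G x y) → isEdge x y ≡ true
  isEdge-intro x<y x~y = cong₂ _∧_ (<ᵇ-true x<y) (Equivalence.to T-≡ x~y)

  onTri-split : ∀ {a b c} → toℕ a < toℕ b → toℕ b < toℕ c → ∀ v →
                𝟙 (onTri G v (a , b , c)) ≡ 𝟙 (v =ᵛ a) + (𝟙 (v =ᵛ b) + 𝟙 (v =ᵛ c))
  onTri-split {a} {b} {c} a<b b<c v = begin
    𝟙 ((v =ᵛ a) ∨ (v =ᵛ b) ∨ (v =ᵛ c))          ≡⟨ 𝟙-∨ (v =ᵛ a) _ exclusive ⟩
    𝟙 (v =ᵛ a) + 𝟙 ((v =ᵛ b) ∨ (v =ᵛ c))        ≡⟨ cong (𝟙 (v =ᵛ a) +_) (=ᵛ-∨-split b<c v) ⟩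
    𝟙 (v =ᵛ a) + (𝟙 (v =ᵛ b) + 𝟙 (v =ᵛ c))      ∎
    where
    exclusive : T (v =ᵛ a) → T ((v =ᵛ b) ∨ (v =ᵛ c)) → ⊥
    exclusive v=a v=b∨c with Equivalence.to T-∨ v=b∨c
    ... | inj₁ v=b = =ᵛ-exclusive {v = v} a<b v=a v=b
    ... | inj₂ v=c = =ᵛ-exclusive {v = v} (<-trans a<b b<c) v=a v=c

  sum-onTri : ∀ {a b c} → toℕ a < toℕ b → toℕ b < toℕ c → (f : Vertex → ℚ) →
              ∑ (λ x → 𝟙 (onTri G x (a , b , c)) * f x) ≡ f a + (f b + f c)
  sum-onTri {a} {b} {c} a<b b<c f =
    trans (sum-cong (V G) (λ x → cong (_* f x) (onTri-split a<b b<c x))) (sum-δ₃ a b c f)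

  inTriangle : Edge G → Triangle G → Bool
  inTriangle (u , w) t = onTri G u t ∧ onTri G w t

  onPairs-triangle : ∀ {a b c} → T (isTriangle a b c) → (g : Edge G → ℚ) →
    let h = onPairs g in
    (h a a + (h a b + h a c)) + ((h b a + (h b b + h b c)) + (h c a + (h c b + h c c)))
      ≡ g (a , b) + (g (a , c) + g (b , c))
  onPairs-triangle {a} {b} {c} abc g = begin
    (h a a + (h a b + h a c)) + ((h b a + (h b b + h b c)) + (h c a + (h c b + h c c)))
      ≡⟨ cong₂ _+_ (cong₂ _+_ (absent (isEdge-irrefl a)) (cong₂ _+_ (present a<b a~b) (present a<c a~c)))
                   (cong₂ _+_ (cong₂ _+_ (absent (isEdge-reverse a<b))
                                         (cong₂ _+_ (absent (isEdge-irrefl b)) (present b<c b~c)))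
                              (cong₂ _+_ (absent (isEdge-reverse a<c))
                                         (cong₂ _+_ (absent (isEdge-reverse b<c)) (absent (isEdge-irrefl c))))) ⟩
    (0ℚ + (g (a , b) + g (a , c))) + ((0ℚ + (0ℚ + g (b , c))) + (0ℚ + (0ℚ + 0ℚ)))
      ≡⟨ solve 3 (λ x y z → (con 0ℚ :+ (x :+ y)) :+ ((con 0ℚ :+ (con 0ℚ :+ z)) :+ (con 0ℚ :+ (con 0ℚ :+ con 0ℚ)))
                            := x :+ (y :+ z)) refl (g (a , b)) (g (a , c)) (g (b , c)) ⟩
    g (a , b) + (g (a , c) + g (b , c))
      ∎
    where
    open TriangleFacts (isTriangle⇒ {a} {b} {c} abc)
    a<c = <-trans a<b b<c
    h = onPairs g
    present : ∀ {x y} → toℕ x < toℕ y → T (adj G x y) → h x y ≡ g (x , y)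
    present x<y x~y = 𝟙-true-* _ (isEdge-intro x<y x~y)
    absent : ∀ {x y} → isEdge x y ≡ false → h x y ≡ 0ℚ
    absent = 𝟙-false-* _

  sum-edges-of-triangle : ∀ {a b c} → T (isTriangle a b c) → (g : Edge G → ℚ) →
    sumℚ (edges G) (λ e → 𝟙 (inTriangle e (a , b , c)) * g e) ≡ g (a , b) + (g (a , c) + g (b , c))
  sum-edges-of-triangle {a} {b} {c} abc g = begin
    sumℚ (edges G) (λ e → 𝟙 (inTriangle e t) * g e)
      ≡⟨ sum-edges _ ⟩
    ∑² (λ u w → 𝟙 (isEdge u w) * (𝟙 (onTri G u t ∧ onTri G w t) * g (u , w)))
      ≡⟨ ∑²-cong (λ u w → 𝟙-∧-hoist (isEdge u w) (onTri G u t) (onTri G w t) (g (u , w))) ⟩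
    ∑ (λ u → ∑ (λ w → 𝟙 (onTri G u t) * (𝟙 (onTri G w t) * h u w)))
      ≡⟨ sum-cong (V G) (λ u → sum-*ˡ (V G) (𝟙 (onTri G u t)) (λ w → 𝟙 (onTri G w t) * h u w)) ⟩
    ∑ (λ u → 𝟙 (onTri G u t) * ∑ (λ w → 𝟙 (onTri G w t) * h u w))
      ≡⟨ sum-cong (V G) (λ u → cong (𝟙 (onTri G u t) *_) (sum-onTri a<b b<c (h u))) ⟩
    ∑ (λ u → 𝟙 (onTri G u t) * (h u a + (h u b + h u c)))
      ≡⟨ sum-onTri a<b b<c (λ u → h u a + (h u b + h u c)) ⟩
    (h a a + (h a b + h a c)) + ((h b a + (h b b + h b c)) + (h c a + (h c b + h c c)))
      ≡⟨ onPairs-triangle abc g ⟩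
    g (a , b) + (g (a , c) + g (b , c))
      ∎
    where
    open TriangleFacts (isTriangle⇒ {a} {b} {c} abc)
    t : Triangle G
    t = a , b , c
    h = onPairs g

  incidences-in-triangle : ∀ {a b c} → toℕ a < toℕ b → toℕ b < toℕ c → ∀ v →
    𝟙 (inEdge G v (a , b)) + (𝟙 (inEdge G v (a , c)) + 𝟙 (inEdge G v (b , c)))
      ≡ 𝟙 (onTri G v (a , b , c)) + 𝟙 (onTri G v (a , b , c))
  incidences-in-triangle {a} {b} {c} a<b b<c v = begin
    𝟙 (inEdge G v (a , b)) + (𝟙 (inEdge G v (a , c)) + 𝟙 (inEdge G v (b , c)))
      ≡⟨ cong₂ _+_ (=ᵛ-∨-split a<b v) (cong₂ _+_ (=ᵛ-∨-split (<-trans a<b b<c) v) (=ᵛ-∨-split b<c v)) ⟩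
    (A + B) + ((A + C) + (B + C))
      ≡⟨ solve 3 (λ A B C → (A :+ B) :+ ((A :+ C) :+ (B :+ C)) := (A :+ (B :+ C)) :+ (A :+ (B :+ C))) refl A B C ⟩
    (A + (B + C)) + (A + (B + C))
      ≡⟨ cong₂ _+_ (onTri-split a<b b<c v) (onTri-split a<b b<c v) ⟨
    𝟙 (onTri G v (a , b , c)) + 𝟙 (onTri G v (a , b , c))
      ∎
    where
    A = 𝟙 (v =ᵛ a)
    B = 𝟙 (v =ᵛ b)
    C = 𝟙 (v =ᵛ c)

  Δe-as-sum : ∀ e → ℕ→ℚ (Δe G e) ≡ sumℚ (triangles G) (𝟙 ∘ inTriangle e)
  Δe-as-sum (u , w) = length-filterᵇ (inTriangle (u , w)) (triangles G)

  sum-Δe-incident : ∀ v →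
    sumℚ (edges G) (λ e → ℕ→ℚ (Δe G e) * 𝟙 (inEdge G v e)) ≡ ℕ→ℚ (Δv G v) + ℕ→ℚ (Δv G v)
  sum-Δe-incident v = begin
    sumℚ (edges G) (λ e → ℕ→ℚ (Δe G e) * 𝟙 (inEdge G v e))
      ≡⟨ sum-cong (edges G) (λ e → trans (cong (_* 𝟙 (inEdge G v e)) (Δe-as-sum e))
                                          (sym (sum-*ʳ (triangles G) _ (𝟙 ∘ inTriangle e)))) ⟩
    sumℚ (edges G) (λ e → sumℚ (triangles G) (λ t → 𝟙 (inTriangle e t) * 𝟙 (inEdge G v e)))
      ≡⟨ sum-comm (edges G) (triangles G) (λ e t → 𝟙 (inTriangle e t) * 𝟙 (inEdge G v e)) ⟩
    sumℚ (triangles G) (λ t → sumℚ (edges G) (λ e → 𝟙 (inTriangle e t) * 𝟙 (inEdge G v e)))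
      ≡⟨ sum-triangles-cong incident-edges ⟩
    sumℚ (triangles G) (λ t → 𝟙 (onTri G v t) + 𝟙 (onTri G v t))
      ≡⟨ sum-+ (triangles G) (𝟙 ∘ onTri G v) (𝟙 ∘ onTri G v) ⟩
    sumℚ (triangles G) (𝟙 ∘ onTri G v) + sumℚ (triangles G) (𝟙 ∘ onTri G v)
      ≡⟨ cong₂ _+_ Δv-as-sum Δv-as-sum ⟨
    ℕ→ℚ (Δv G v) + ℕ→ℚ (Δv G v)
      ∎
    where
    Δv-as-sum = length-filterᵇ (onTri G v) (triangles G)
    incident-edges : ∀ a b c → T (isTriangle a b c) →
      sumℚ (edges G) (λ e → 𝟙 (inTriangle e (a , b , c)) * 𝟙 (inEdge G v e))
        ≡ 𝟙 (onTri G v (a , b , c)) + 𝟙 (onTri G v (a , b , c))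
    incident-edges a b c abc = trans (sum-edges-of-triangle abc (𝟙 ∘ inEdge G v))
                                     (incidences-in-triangle a<b b<c v)
      where open TriangleFacts (isTriangle⇒ {a} {b} {c} abc)

  module _ (v x y : Vertex) where

    private
      x<ᵇy = toℕ x <ᵇ toℕ y
      v<ᵇx = toℕ v <ᵇ toℕ x
      x<ᵇv = toℕ x <ᵇ toℕ v
      v<ᵇy = toℕ v <ᵇ toℕ y
      y<ᵇv = toℕ y <ᵇ toℕ v
      xy = adj G x y
      xv = adj G x v
      yv = adj G y v
      clique = xy ∧ (xv ∧ yv)
      position = 𝟙 v<ᵇx * 𝟙 x<ᵇy + (𝟙 x<ᵇv * 𝟙 v<ᵇy + 𝟙 x<ᵇy * 𝟙 y<ᵇv)

      𝟙-clique : 𝟙 clique ≡ 𝟙 xy * (𝟙 xv * 𝟙 yv)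
      𝟙-clique = trans (𝟙-∧ xy _) (cong (𝟙 xy *_) (𝟙-∧ xv yv))

    𝟙-triangles-through : 𝟙 (isTriangle v x y) + (𝟙 (isTriangle x v y) + 𝟙 (isTriangle x y v)) ≡ 𝟙 clique * position
    𝟙-triangles-through = begin
      𝟙 (isTriangle v x y) + (𝟙 (isTriangle x v y) + 𝟙 (isTriangle x y v))
        ≡⟨ cong₂ _+_ v-smallest (cong₂ _+_ v-middle v-largest) ⟩
      𝟙 v<ᵇx * (𝟙 x<ᵇy * (𝟙 xv * (𝟙 xy * 𝟙 yv)))
        + (𝟙 x<ᵇv * (𝟙 v<ᵇy * (𝟙 xv * (𝟙 yv * 𝟙 xy))) + 𝟙 x<ᵇy * (𝟙 y<ᵇv * (𝟙 xy * (𝟙 yv * 𝟙 xv))))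
        ≡⟨ solve 8 (λ K₁ K₂ K₃ P Q R S U →
                     Q :* (P :* (K₂ :* (K₁ :* K₃))) :+ (R :* (S :* (K₂ :* (K₃ :* K₁))) :+ P :* (U :* (K₁ :* (K₃ :* K₂))))
                  := (K₁ :* (K₂ :* K₃)) :* (Q :* P :+ (R :* S :+ P :* U)))
                 refl (𝟙 xy) (𝟙 xv) (𝟙 yv) (𝟙 x<ᵇy) (𝟙 v<ᵇx) (𝟙 x<ᵇv) (𝟙 v<ᵇy) (𝟙 y<ᵇv) ⟩
      (𝟙 xy * (𝟙 xv * 𝟙 yv)) * position
        ≡⟨ cong (_* position) 𝟙-clique ⟨
      𝟙 clique * position
        ∎
      where
      v-smallest : 𝟙 (isTriangle v x y) ≡ 𝟙 v<ᵇx * (𝟙 x<ᵇy * (𝟙 xv * (𝟙 xy * 𝟙 yv)))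
      v-smallest = trans (𝟙-∧₅ v<ᵇx x<ᵇy (adj G v x) xy (adj G v y))
        (cong₂ (λ p q → 𝟙 v<ᵇx * (𝟙 x<ᵇy * (𝟙 p * (𝟙 xy * 𝟙 q)))) (adj-sym G v x) (adj-sym G v y))
      v-middle : 𝟙 (isTriangle x v y) ≡ 𝟙 x<ᵇv * (𝟙 v<ᵇy * (𝟙 xv * (𝟙 yv * 𝟙 xy)))
      v-middle = trans (𝟙-∧₅ x<ᵇv v<ᵇy xv (adj G v y) xy)
        (cong (λ q → 𝟙 x<ᵇv * (𝟙 v<ᵇy * (𝟙 xv * (𝟙 q * 𝟙 xy)))) (adj-sym G v y))
      v-largest : 𝟙 (isTriangle x y v) ≡ 𝟙 x<ᵇy * (𝟙 y<ᵇv * (𝟙 xy * (𝟙 yv * 𝟙 xv)))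
      v-largest = 𝟙-∧₅ x<ᵇy y<ᵇv xy yv xv

    -- A common neighbour v of the edge xy completes the triangle {v, x, y}, in which v is the
    -- smallest, the middle or the largest vertex.
    𝟙-common-neighbours :
      𝟙 (isEdge x y) * 𝟙 (inNe G v (x , y)) ≡ 𝟙 (isTriangle v x y) + (𝟙 (isTriangle x v y) + 𝟙 (isTriangle x y v))
    𝟙-common-neighbours = begin
      𝟙 (isEdge x y) * 𝟙 (inNe G v (x , y))
        ≡⟨ cong₂ _*_ (𝟙-∧ x<ᵇy xy) (𝟙-∧ xv yv) ⟩
      (𝟙 x<ᵇy * 𝟙 xy) * (𝟙 xv * 𝟙 yv)
        ≡⟨ solve 4 (λ P K₁ K₂ K₃ → (P :* K₁) :* (K₂ :* K₃) := (K₁ :* (K₂ :* K₃)) :* P) refl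
                 (𝟙 x<ᵇy) (𝟙 xy) (𝟙 xv) (𝟙 yv) ⟩
      (𝟙 xy * (𝟙 xv * 𝟙 yv)) * 𝟙 x<ᵇy
        ≡⟨ cong (_* 𝟙 x<ᵇy) 𝟙-clique ⟨
      𝟙 clique * 𝟙 x<ᵇy
        ≡⟨ 𝟙-guard clique by-position ⟩
      𝟙 clique * position
        ≡⟨ 𝟙-triangles-through ⟨
      𝟙 (isTriangle v x y) + (𝟙 (isTriangle x v y) + 𝟙 (isTriangle x y v))
        ∎
      where
      by-position : T clique → 𝟙 x<ᵇy ≡ position
      by-position x~y∧x~v∧y~v =
        let x~v , y~v = Equivalence.to (T-∧ {xv} {yv}) (proj₂ (Equivalence.to (T-∧ {xy}) x~y∧x~v∧y~v))
        in 𝟙<ᵇ-by-position (adj⇒≢ {x} {v} x~v) (adj⇒≢ {y} {v} y~v)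

  Δv-by-position : ∀ v → ℕ→ℚ (Δv G v)
    ≡ ∑² (λ x y → 𝟙 (isTriangle v x y)) + (∑² (λ x y → 𝟙 (isTriangle x v y)) + ∑² (λ x y → 𝟙 (isTriangle x y v)))
  Δv-by-position v = begin
    ℕ→ℚ (Δv G v)
      ≡⟨ length-filterᵇ (onTri G v) (triangles G) ⟩
    sumℚ (triangles G) (𝟙 ∘ onTri G v)
      ≡⟨ sum-triangles (𝟙 ∘ onTri G v) ⟩
    ∑³ (λ a b c → 𝟙 (isTriangle a b c) * 𝟙 (onTri G v (a , b , c)))
      ≡⟨ ∑³-cong split ⟩
    ∑³ (λ a b c → at a a b c + (at b a b c + at c a b c))
      ≡⟨ ∑³-+₃ (λ a b c → at a a b c) (λ a b c → at b a b c) (λ a b c → at c a b c) ⟩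
    ∑³ (λ a b c → at a a b c) + (∑³ (λ a b c → at b a b c) + ∑³ (λ a b c → at c a b c))
      ≡⟨ cong₂ _+_ smallest (cong₂ _+_ middle largest) ⟩
    ∑² (λ x y → 𝟙 (isTriangle v x y)) + (∑² (λ x y → 𝟙 (isTriangle x v y)) + ∑² (λ x y → 𝟙 (isTriangle x y v)))
      ∎
    where
    at : Vertex → Vertex → Vertex → Vertex → ℚ
    at x a b c = 𝟙 (v =ᵛ x) * 𝟙 (isTriangle a b c)
    split : ∀ a b c → 𝟙 (isTriangle a b c) * 𝟙 (onTri G v (a , b , c)) ≡ at a a b c + (at b a b c + at c a b c)
    split a b c = trans (𝟙-guard (isTriangle a b c) λ abc → let open TriangleFacts (isTriangle⇒ {a} {b} {c} abc)
                                                            in onTri-split a<b b<c v)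
      (solve 4 (λ Δ A B C → Δ :* (A :+ (B :+ C)) := A :* Δ :+ (B :* Δ :+ C :* Δ)) refl
             (𝟙 (isTriangle a b c)) (𝟙 (v =ᵛ a)) (𝟙 (v =ᵛ b)) (𝟙 (v =ᵛ c)))
    smallest : ∑³ (λ a b c → at a a b c) ≡ ∑² (λ x y → 𝟙 (isTriangle v x y))
    smallest = trans (sum-cong (V G) λ a → trans (sum-cong (V G) λ b → sum-*ˡ (V G) (𝟙 (v =ᵛ a)) (λ c → 𝟙 (isTriangle a b c)))
                                                 (sum-*ˡ (V G) (𝟙 (v =ᵛ a)) (λ b → ∑ (λ c → 𝟙 (isTriangle a b c)))))
                     (sum-δ′ v (λ a → ∑² (λ b c → 𝟙 (isTriangle a b c))))
    middle : ∑³ (λ a b c → at b a b c) ≡ ∑² (λ x y → 𝟙 (isTriangle x v y))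
    middle = sum-cong (V G) λ a → trans (sum-cong (V G) λ b → sum-*ˡ (V G) (𝟙 (v =ᵛ b)) (λ c → 𝟙 (isTriangle a b c)))
                                        (sum-δ′ v (λ b → ∑ (λ c → 𝟙 (isTriangle a b c))))
    largest : ∑³ (λ a b c → at c a b c) ≡ ∑² (λ x y → 𝟙 (isTriangle x y v))
    largest = sum-cong (V G) λ a → sum-cong (V G) λ b → sum-δ′ v (λ c → 𝟙 (isTriangle a b c))

  sum-inNe : ∀ v → sumℚ (edges G) (𝟙 ∘ inNe G v) ≡ ℕ→ℚ (Δv G v)
  sum-inNe v = begin
    sumℚ (edges G) (𝟙 ∘ inNe G v)
      ≡⟨ sum-edges (𝟙 ∘ inNe G v) ⟩
    ∑² (λ x y → 𝟙 (isEdge x y) * 𝟙 (inNe G v (x , y)))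
      ≡⟨ ∑²-cong (𝟙-common-neighbours v) ⟩
    ∑² (λ x y → 𝟙 (isTriangle v x y) + (𝟙 (isTriangle x v y) + 𝟙 (isTriangle x y v)))
      ≡⟨ ∑²-+₃ (λ x y → 𝟙 (isTriangle v x y)) (λ x y → 𝟙 (isTriangle x v y)) (λ x y → 𝟙 (isTriangle x y v)) ⟩
    ∑² (λ x y → 𝟙 (isTriangle v x y)) + (∑² (λ x y → 𝟙 (isTriangle x v y)) + ∑² (λ x y → 𝟙 (isTriangle x y v)))
      ≡⟨ Δv-by-position v ⟨
    ℕ→ℚ (Δv G v)
      ∎

  sum-aq : ∀ q v → sumℚ (edges G) (aq G q v) ≡ ℕ→ℚ (Δv G v)
  sum-aq q v = begin
    sumℚ (edges G) (aq G q v)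
      ≡⟨ sum-+ (edges G) (λ e → q * ℕ→ℚ (Δe G e) * 𝟙 (inEdge G v e)) (λ e → r * 𝟙 (inNe G v e)) ⟩
    sumℚ (edges G) (λ e → q * ℕ→ℚ (Δe G e) * 𝟙 (inEdge G v e)) + sumℚ (edges G) (λ e → r * 𝟙 (inNe G v e))
      ≡⟨ cong (_+ sumℚ (edges G) (λ e → r * 𝟙 (inNe G v e)))
              (sum-cong (edges G) (λ e → *-assoc q (ℕ→ℚ (Δe G e)) (𝟙 (inEdge G v e)))) ⟩
    sumℚ (edges G) (λ e → q * (ℕ→ℚ (Δe G e) * 𝟙 (inEdge G v e))) + sumℚ (edges G) (λ e → r * 𝟙 (inNe G v e))
      ≡⟨ cong₂ _+_ (sum-*ˡ (edges G) q (λ e → ℕ→ℚ (Δe G e) * 𝟙 (inEdge G v e)))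
                   (sum-*ˡ (edges G) r (𝟙 ∘ inNe G v)) ⟩
    q * sumℚ (edges G) (λ e → ℕ→ℚ (Δe G e) * 𝟙 (inEdge G v e)) + r * sumℚ (edges G) (𝟙 ∘ inNe G v)
      ≡⟨ cong₂ _+_ (cong (q *_) (sum-Δe-incident v)) (cong (r *_) (sum-inNe v)) ⟩
    q * (Δ + Δ) + r * Δ
      ≡⟨ solve 2 (λ q Δ → q :* (Δ :+ Δ) :+ (con 1ℚ :- con (ℕ→ℚ 2) :* q) :* Δ := Δ) refl q Δ ⟩
    Δ ∎
    where
    r = 1ℚ - ℕ→ℚ 2 * q
    Δ = ℕ→ℚ (Δv G v)

  sum-edges-select : ∀ u w (h : Edge G → ℚ) →
    sumℚ (edges G) (λ e → 𝟙 (_=ᵉ_ G e (u , w)) * h e) ≡ 𝟙 (isEdge u w) * h (u , w)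
  sum-edges-select u w h = begin
    sumℚ (edges G) (λ e → 𝟙 (_=ᵉ_ G e (u , w)) * h e)
      ≡⟨ sum-edges _ ⟩
    ∑² (λ u′ w′ → 𝟙 (isEdge u′ w′) * (𝟙 ((u′ =ᵛ u) ∧ (w′ =ᵛ w)) * h (u′ , w′)))
      ≡⟨ ∑²-cong (λ u′ w′ → 𝟙-∧-hoist (isEdge u′ w′) (u′ =ᵛ u) (w′ =ᵛ w) (h (u′ , w′))) ⟩
    ∑ (λ u′ → ∑ (λ w′ → 𝟙 (u′ =ᵛ u) * (𝟙 (w′ =ᵛ w) * e u′ w′)))
      ≡⟨ sum-cong (V G) (λ u′ → trans (sum-*ˡ (V G) (𝟙 (u′ =ᵛ u)) (λ w′ → 𝟙 (w′ =ᵛ w) * e u′ w′))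
                                       (cong (𝟙 (u′ =ᵛ u) *_) (sum-δ w (e u′)))) ⟩
    ∑ (λ u′ → 𝟙 (u′ =ᵛ u) * e u′ w)
      ≡⟨ sum-δ u (λ u′ → e u′ w) ⟩
    𝟙 (isEdge u w) * h (u , w)
      ∎
    where
    e = onPairs h

-- The sampled estimator

module _ (G : Graph) {k : ℕ} (part : Fin (n G) → Fin k) where

  horvitz-thompson-unbiased : ℕ→ℚ (m G part) ≢ 0ℚ → ∀ (τ : Edge G → ℚ) →
    expect G part (λ e → sumℚ (edges G) (λ e′ → (X G part e e′ ÷₀ p G part) * τ e′)) ≡ sumℚ (edges G) τ
  horvitz-thompson-unbiased m≢0 τ = sum-edges-cong G λ u w uw → begin
    (1ℚ ÷₀ M) * sumℚ (edges G) (λ e′ → (𝟙 (_=ᵉ_ G e′ (u , w)) ÷₀ (1ℚ ÷₀ M)) * τ e′)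
      ≡⟨ cong ((1ℚ ÷₀ M) *_) (sum-cong (edges G) λ e′ → reweight (𝟙 (_=ᵉ_ G e′ (u , w))) (τ e′)) ⟩
    (1ℚ ÷₀ M) * sumℚ (edges G) (λ e′ → 𝟙 (_=ᵉ_ G e′ (u , w)) * (M * τ e′))
      ≡⟨ cong ((1ℚ ÷₀ M) *_) (sum-edges-select G u w (λ e′ → M * τ e′)) ⟩
    (1ℚ ÷₀ M) * (𝟙 (isEdge G u w) * (M * τ (u , w)))
      ≡⟨ cong ((1ℚ ÷₀ M) *_) (𝟙-true-* (M * τ (u , w)) (Equivalence.to T-≡ uw)) ⟩
    (1ℚ ÷₀ M) * (M * τ (u , w))
      ≡⟨ *-assoc (1ℚ ÷₀ M) M (τ (u , w)) ⟨
    (1ℚ ÷₀ M) * M * τ (u , w)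
      ≡⟨ cong (_* τ (u , w)) (1÷₀-inverseˡ M m≢0) ⟩
    1ℚ * τ (u , w)
      ≡⟨ *-identityˡ (τ (u , w)) ⟩
    τ (u , w)
      ∎
    where
    M = ℕ→ℚ (m G part)
    reweight : ∀ x t → (x ÷₀ (1ℚ ÷₀ M)) * t ≡ x * (M * t)
    reweight x t = trans (cong (_* t) (trans (x÷₀y≡x*[1÷₀y] x (1ℚ ÷₀ M)) (cong (x *_) (1÷₀-involutive M))))
                         (*-assoc x M t)

lemma3p3 : (G : Graph) → 1 ≤ length (edges G)
    → (k : ℕ) (part : Fin (n G) → Fin k) → (∀ j → ∃ λ v → part v ≡ j)
    → (ψ : Coef) (q : ℚ) → 0ℚ Data.Rational.≤ q → q Data.Rational.≤ ½
    → ∀ j → expect G part (f G part ψ q j) ≡ Ψ G part ψ j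
-- The identity holds for every q and every partition; only m ≥ 1 is used.
lemma3p3 G m≥1 k part _ ψ q _ _ j = begin
  expect G part (f G part ψ q j)
    ≡⟨ horvitz-thompson-unbiased G part (ℕ→ℚ-≢0 m≥1) (λ e → c * S e) ⟩
  sumℚ (edges G) (λ e → c * S e)
    ≡⟨ sum-*ˡ (edges G) c S ⟩
  c * sumℚ (edges G) S
    ≡⟨ cong (c *_) (sum-comm (edges G) (block G part j) (λ e v → aq G q v e ÷₀ Wstar G ψ v)) ⟩
  c * sumℚ (block G part j) (λ v → sumℚ (edges G) (λ e → aq G q v e ÷₀ Wstar G ψ v))
    ≡⟨ cong (c *_) (sum-cong (block G part j) λ v →
         trans (sum-÷₀ (edges G) (aq G q v) (Wstar G ψ v)) (cong (_÷₀ Wstar G ψ v) (sum-aq G q v))) ⟩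
  Ψ G part ψ j
    ∎
  where
  c = 1ℚ ÷₀ ℕ→ℚ (length (block G part j))
  S : Edge G → ℚ
  S e = sumℚ (block G part j) (λ v → aq G q v e ÷₀ Wstar G ψ v)
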